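{- For all integers $n\geq 3$ and $s\geq 2$, \[ac(n,s)=ac(n-1,s)+ac(n-2,s)+2\cdot ac(n-3,s-2)-ac(n-3,s).\]
   Context: A composition of $n$ of length $s$ is a sequence $\sigma=(\sigma_1,\ldots,\sigma_s)$ of positive integers with $\sum_i\sigma_i=n$; the empty composition is the unique composition of $0$, of length $0$. A composition is anti-palindromic if $\sigma_i\neq\sigma_{s-i+1}$ for all $i$ with $i\neq\frac{s+1}{2}$ (the empty composition is vacuously anti-palindromic). $ac(n,s)$ is the number of anti-palindromic compositions of $n$ of length $s$. -}

module Defs where

open import Data.Nat using (ℕ; zero; suc; _+_; _∸_)
open import Data.Fin using (Fin; toℕ; opposite)
open import Data.Vec using (Vec; []; _∷_; lookup)
open import Data.List using (List; []; _∷_; map; concatMap; filter; length; upTo; sum)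
open import Relation.Binary.PropositionalEquality using (_≡_)
open import Relation.Nullary using (¬_; Dec; yes; no)

open import Relation.Nullary.Decidable using (_→-dec_; ¬?)
import Data.Nat as N
import Data.Fin.Properties as FP

compositions : (n s : ℕ) → List (Vec ℕ s)
compositions zero zero = [] ∷ []
compositions (suc n) zero = []
compositions n (suc s) =
  concatMap (λ k → map (λ rest → suc k ∷ rest) (compositions (n ∸ suc k) s))
            (upTo n)

-- σ is anti-palindromic: σ_i ≠ σ_{s-i+1} for every index i that is not the
-- middle one (opposite i is the mirror index s-1-i in 0-based indexing).
AntiPalindromic : {s : ℕ} → Vec ℕ s → Set
AntiPalindromic {s} σ =
  (i : Fin s) → ¬ (toℕ i ≡ toℕ (opposite i)) → ¬ (lookup σ i ≡ lookup σ (opposite i))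

antiPalindromic? : {s : ℕ} → (σ : Vec ℕ s) → Dec (AntiPalindromic σ)
antiPalindromic? σ = FP.all? (λ i →
  ¬? (toℕ i N.≟ toℕ (opposite i)) →-dec ¬? (lookup σ i N.≟ lookup σ (opposite i)))

ac : ℕ → ℕ → ℕ
ac n s = length (filter antiPalindromic? (compositions n s))

-- Removing the two end parts, an anti-palindromic composition of n of length t + 2 is a
-- pair of distinct end parts p ≠ q together with an arbitrary anti-palindromic composition
-- of n − p − q of length t (the mirror pairs of the inner part are those of the whole).
-- Hence ac(n, t+2) = Σ_{p+q+r=n, p≠q} ac(r, t). Sorting the terms by p = 1, q = 1, or
-- p, q ≥ 2, and lowering both end parts by one in the last case, gives
--   ac(m+2, t+2) = 2 Σ_{r<m} ac(r, t) + ac(m, t+2),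
-- and the difference of this identity at m + 1 and at m is the recurrence.
{-# OPTIONS --safe #-}
module Submission where

open import Defs
open import Data.Nat using (ℕ; _≤_; _∸_)
open import Data.Integer using (+_; _+_; _-_; _*_; _⊖_)
open import Relation.Binary.PropositionalEquality using (_≡_)

open import Data.Bool using (if_then_else_)
open import Data.Fin using (Fin; zero; suc; toℕ; opposite; fromℕ; inject₁)
open import Data.Fin.Properties using (toℕ-inject₁)
open import Data.Fin.Relation.Unary.Top using (view; ‵fromℕ; ‵inject₁)
open import Data.Integer.Properties using (pos-+; pos-*; ⊖-≥; [+m]-[+n]≡m⊖n)
open import Data.List using (List; []; _∷_; map; concatMap; filter; length; upTo; applyUpTo; _++_)
open import Data.List.Properties using (map-++; map-∘)
open import Data.Nat as ℕ using (zero; suc; s≤s; _≟_)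
open import Data.Nat.ListAction using (sum)
open import Data.Nat.ListAction.Properties using (sum-++)
import Data.Nat.Properties as ℕ
open import Data.Nat.Solver using (module +-*-Solver)
open import Data.Product using (_×_; _,_)
open import Data.Vec using (Vec; []; _∷_; lookup; _∷ʳ_)
open import Function using (_∘_; _⇔_; mk⇔)
open import Relation.Binary.PropositionalEquality
  using (_≢_; refl; sym; trans; cong; cong₂; module ≡-Reasoning)
open import Relation.Nullary using (Dec; yes; no; does; ¬?; _×-dec_)
open import Relation.Nullary.Decidable using (does-⇔)

private
  variable
    A P Q : Set

Σ< : ℕ → (ℕ → ℕ) → ℕ
Σ< zero    f = 0
Σ< (suc n) f = f 0 ℕ.+ Σ< n (f ∘ suc)

Σ<-cong : ∀ n {f g : ℕ → ℕ} → (∀ k → f k ≡ g k) → Σ< n f ≡ Σ< n g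
Σ<-cong zero    f≗g = refl
Σ<-cong (suc n) f≗g = cong₂ ℕ._+_ (f≗g 0) (Σ<-cong n (f≗g ∘ suc))

sum-map-applyUpTo : ∀ (f g : ℕ → ℕ) n → sum (map f (applyUpTo g n)) ≡ Σ< n (f ∘ g)
sum-map-applyUpTo f g zero    = refl
sum-map-applyUpTo f g (suc n) = cong (f (g 0) ℕ.+_) (sum-map-applyUpTo f (g ∘ suc) n)

sum-map-concatMap : ∀ {B : Set} (f : B → ℕ) (g : A → List B) xs →
  sum (map f (concatMap g xs)) ≡ sum (map (sum ∘ map f ∘ g) xs)
sum-map-concatMap f g []       = refl
sum-map-concatMap f g (x ∷ xs) = begin
  sum (map f (g x ++ concatMap g xs))
    ≡⟨ cong sum (map-++ f (g x) _) ⟩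
  sum (map f (g x) ++ map f (concatMap g xs))
    ≡⟨ sum-++ (map f (g x)) _ ⟩
  sum (map f (g x)) ℕ.+ sum (map f (concatMap g xs))
    ≡⟨ cong (_ ℕ.+_) (sum-map-concatMap f g xs) ⟩
  sum (map f (g x)) ℕ.+ sum (map (sum ∘ map f ∘ g) xs) ∎
  where open ≡-Reasoning

sum-map-cong : ∀ {f g : A → ℕ} xs → (∀ x → f x ≡ g x) → sum (map f xs) ≡ sum (map g xs)
sum-map-cong []       f≗g = refl
sum-map-cong (x ∷ xs) f≗g = cong₂ ℕ._+_ (f≗g x) (sum-map-cong xs f≗g)

sum-map-*ˡ : ∀ c (f : A → ℕ) xs → sum (map (λ x → c ℕ.* f x) xs) ≡ c ℕ.* sum (map f xs)
sum-map-*ˡ c f []       = sym (ℕ.*-zeroʳ c)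
sum-map-*ˡ c f (x ∷ xs) =
  trans (cong (c ℕ.* f x ℕ.+_) (sum-map-*ˡ c f xs)) (sym (ℕ.*-distribˡ-+ c (f x) _))

-- Σ△ n h sums h k b r over all k, b, r with k + b + r + 2 ≡ n.
Σ△ : ℕ → (ℕ → ℕ → ℕ → ℕ) → ℕ
Σ△ n h = Σ< n (λ k → Σ< (n ∸ suc k) (λ b → h k b (n ∸ suc k ∸ suc b)))

Σ△-suc : ∀ n h →
  Σ△ (suc n) h ≡ Σ< n (λ k → h k 0 (n ∸ suc k)) ℕ.+ Σ△ n (λ k b → h k (suc b))
Σ△-suc zero    h = refl
Σ△-suc (suc n) h =
  trans (cong (h 0 0 n ℕ.+ Σ< n (λ b → h 0 (suc b) (n ∸ suc b)) ℕ.+_) (Σ△-suc n (h ∘ suc)))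
        (+-interchange (h 0 0 n) _ _ _)
  where
  open +-*-Solver
  +-interchange : ∀ x a b c → (x ℕ.+ a) ℕ.+ (b ℕ.+ c) ≡ (x ℕ.+ b) ℕ.+ (a ℕ.+ c)
  +-interchange = solve 4 (λ x a b c → (x :+ a) :+ (b :+ c) := (x :+ b) :+ (a :+ c)) refl

Σ△-swap : ∀ n h → Σ△ n h ≡ Σ△ n (λ k b → h b k)
Σ△-swap zero    h = refl
Σ△-swap (suc n) h =
  trans (cong (Σ< n (λ b → h 0 b (n ∸ suc b)) ℕ.+_) (Σ△-swap n (h ∘ suc)))
        (sym (Σ△-suc n (λ k b → h b k)))

Σcomp : (n s : ℕ) → (Vec ℕ s → ℕ) → ℕ
Σcomp n s f = sum (map f (compositions n s))

Σcomp-cong : ∀ n s {f g : Vec ℕ s → ℕ} → (∀ σ → f σ ≡ g σ) → Σcomp n s f ≡ Σcomp n s g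
Σcomp-cong n s = sum-map-cong (compositions n s)

Σcomp-*ˡ : ∀ n s c (f : Vec ℕ s → ℕ) → Σcomp n s (λ σ → c ℕ.* f σ) ≡ c ℕ.* Σcomp n s f
Σcomp-*ˡ n s c f = sum-map-*ˡ c f (compositions n s)

compositions-suc : ∀ n s → compositions n (suc s) ≡
  concatMap (λ k → map (suc k ∷_) (compositions (n ∸ suc k) s)) (upTo n)
compositions-suc zero    s = refl
compositions-suc (suc n) s = refl

Σcomp-head : ∀ n s (f : Vec ℕ (suc s) → ℕ) →
  Σcomp n (suc s) f ≡ Σ< n (λ k → Σcomp (n ∸ suc k) s (f ∘ (suc k ∷_)))
Σcomp-head n s f = begin
  sum (map f (compositions n (suc s)))
    ≡⟨ cong (sum ∘ map f) (compositions-suc n s) ⟩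
  sum (map f (concatMap parts (upTo n)))
    ≡⟨ sum-map-concatMap f parts (upTo n) ⟩
  sum (map (sum ∘ map f ∘ parts) (upTo n))
    ≡⟨ sum-map-applyUpTo (sum ∘ map f ∘ parts) (λ k → k) n ⟩
  Σ< n (sum ∘ map f ∘ parts)
    ≡⟨ Σ<-cong n (λ k → cong sum (sym (map-∘ (compositions (n ∸ suc k) s)))) ⟩
  Σ< n (λ k → Σcomp (n ∸ suc k) s (f ∘ (suc k ∷_))) ∎
  where
  open ≡-Reasoning
  parts : ℕ → List (Vec ℕ (suc s))
  parts k = map (suc k ∷_) (compositions (n ∸ suc k) s)

Σcomp-last : ∀ s n (f : Vec ℕ (suc s) → ℕ) →
  Σcomp n (suc s) f ≡ Σ< n (λ b → Σcomp (n ∸ suc b) s (λ σ → f (σ ∷ʳ suc b)))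
Σcomp-last zero n f =
  trans (Σcomp-head n zero f) (Σ<-cong n (λ k → Σcomp-cong (n ∸ suc k) zero λ { [] → refl }))
Σcomp-last (suc s) n f = begin
  Σcomp n (suc (suc s)) f
    ≡⟨ Σcomp-head n (suc s) f ⟩
  Σ< n (λ a → Σcomp (n ∸ suc a) (suc s) (f ∘ (suc a ∷_)))
    ≡⟨ Σ<-cong n (λ a → Σcomp-last s (n ∸ suc a) (f ∘ (suc a ∷_))) ⟩
  Σ△ n ends
    ≡⟨ Σ△-swap n ends ⟩
  Σ△ n (λ b a → ends a b)
    ≡⟨ Σ<-cong n (λ b → Σcomp-head (n ∸ suc b) s (λ σ → f (σ ∷ʳ suc b))) ⟨
  Σ< n (λ b → Σcomp (n ∸ suc b) (suc s) (λ σ → f (σ ∷ʳ suc b))) ∎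
  where
  open ≡-Reasoning
  ends : ℕ → ℕ → ℕ → ℕ
  ends a b r = Σcomp r s (λ σ → f (suc a ∷ (σ ∷ʳ suc b)))

opposite-inject₁ : ∀ {n} (i : Fin n) → opposite (inject₁ i) ≡ suc (opposite i)
opposite-inject₁ {suc n} zero    = refl
opposite-inject₁ {suc n} (suc i) = cong inject₁ (opposite-inject₁ i)

opposite-fromℕ : ∀ n → opposite (fromℕ n) ≡ zero
opposite-fromℕ zero    = refl
opposite-fromℕ (suc n) = cong inject₁ (opposite-fromℕ n)

lookup-∷ʳ-inject₁ : ∀ {n} (u : Vec A n) x i → lookup (u ∷ʳ x) (inject₁ i) ≡ lookup u i
lookup-∷ʳ-inject₁ (y ∷ u) x zero    = refl
lookup-∷ʳ-inject₁ (y ∷ u) x (suc i) = lookup-∷ʳ-inject₁ u x i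

lookup-∷ʳ-fromℕ : ∀ {n} (u : Vec A n) x → lookup (u ∷ʳ x) (fromℕ n) ≡ x
lookup-∷ʳ-fromℕ []      x = refl
lookup-∷ʳ-fromℕ (y ∷ u) x = lookup-∷ʳ-fromℕ u x

antiPalindromic-∷-∷ʳ : ∀ {s} a b (u : Vec ℕ s) →
  AntiPalindromic (a ∷ (u ∷ʳ b)) ⇔ (a ≢ b × AntiPalindromic u)
antiPalindromic-∷-∷ʳ {s} a b u = mk⇔ to from
  where
  σ = a ∷ (u ∷ʳ b)

  opposite-inner : (i : Fin s) → opposite (suc (inject₁ i)) ≡ suc (inject₁ (opposite i))
  opposite-inner i = cong inject₁ (opposite-inject₁ i)

  lookup-inner-mirror : ∀ i → lookup σ (opposite (suc (inject₁ i))) ≡ lookup u (opposite i)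
  lookup-inner-mirror i =
    trans (cong (lookup σ) (opposite-inner i)) (lookup-∷ʳ-inject₁ u b (opposite i))

  toℕ-opposite-inner : ∀ i → toℕ (opposite (suc (inject₁ i))) ≡ suc (toℕ (opposite i))
  toℕ-opposite-inner i =
    trans (cong toℕ (opposite-inner i)) (cong suc (toℕ-inject₁ (opposite i)))

  middle-inner⇒middle : ∀ i → toℕ (suc (inject₁ i)) ≡ toℕ (opposite (suc (inject₁ i))) →
                        toℕ i ≡ toℕ (opposite i)
  middle-inner⇒middle i eq =
    ℕ.suc-injective (trans (cong suc (sym (toℕ-inject₁ i))) (trans eq (toℕ-opposite-inner i)))

  middle⇒middle-inner : ∀ i → toℕ i ≡ toℕ (opposite i) →
                        toℕ (suc (inject₁ i)) ≡ toℕ (opposite (suc (inject₁ i)))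
  middle⇒middle-inner i eq =
    trans (cong suc (toℕ-inject₁ i)) (trans (cong suc eq) (sym (toℕ-opposite-inner i)))

  to : AntiPalindromic σ → a ≢ b × AntiPalindromic u
  to ap = (λ a≡b → ap zero (λ ()) (trans a≡b (sym (lookup-∷ʳ-fromℕ u b))))
        , λ i i≢ī eq → ap (suc (inject₁ i)) (i≢ī ∘ middle-inner⇒middle i)
            (trans (lookup-∷ʳ-inject₁ u b i) (trans eq (sym (lookup-inner-mirror i))))

  from : a ≢ b × AntiPalindromic u → AntiPalindromic σ
  from (a≢b , ap) zero    _    eq = a≢b (trans eq (lookup-∷ʳ-fromℕ u b))
  from (a≢b , ap) (suc j) j≢j̄ eq with view j
  ... | ‵fromℕ     = a≢b (sym (trans (sym (lookup-∷ʳ-fromℕ u b))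
                      (trans eq (cong (lookup σ ∘ inject₁) (opposite-fromℕ s)))))
  ... | ‵inject₁ i = ap i (j≢j̄ ∘ middle⇒middle-inner i)
                      (trans (sym (lookup-∷ʳ-inject₁ u b i)) (trans eq (lookup-inner-mirror i)))

-- Defined through does, so that 𝟙 (¬? (suc k ≟ suc b)) reduces to 𝟙 (¬? (k ≟ b)).
𝟙 : Dec P → ℕ
𝟙 p = if does p then 1 else 0

𝟙-×-dec : (p : Dec P) (q : Dec Q) → 𝟙 (p ×-dec q) ≡ 𝟙 p ℕ.* 𝟙 q
𝟙-×-dec (yes _) q = sym (ℕ.+-identityʳ (𝟙 q))
𝟙-×-dec (no _)  q = refl

length-filter≡sum-𝟙 : ∀ {P : A → Set} (P? : ∀ x → Dec (P x)) xs →
  length (filter P? xs) ≡ sum (map (𝟙 ∘ P?) xs)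
length-filter≡sum-𝟙 P? []       = refl
length-filter≡sum-𝟙 P? (x ∷ xs) with P? x
... | yes _ = cong suc (length-filter≡sum-𝟙 P? xs)
... | no _  = length-filter≡sum-𝟙 P? xs

𝟙-antiPalindromic-∷-∷ʳ : ∀ {s} a b (u : Vec ℕ s) →
  𝟙 (antiPalindromic? (a ∷ (u ∷ʳ b))) ≡ 𝟙 (¬? (a ≟ b)) ℕ.* 𝟙 (antiPalindromic? u)
𝟙-antiPalindromic-∷-∷ʳ a b u =
  trans (cong (λ d → if d then 1 else 0)
              (does-⇔ (antiPalindromic-∷-∷ʳ a b u) (antiPalindromic? (a ∷ (u ∷ʳ b)))
                      (¬? (a ≟ b) ×-dec antiPalindromic? u)))
        (𝟙-×-dec (¬? (a ≟ b)) (antiPalindromic? u))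

ac≡Σcomp : ∀ n s → ac n s ≡ Σcomp n s (𝟙 ∘ antiPalindromic?)
ac≡Σcomp n s = length-filter≡sum-𝟙 antiPalindromic? (compositions n s)

ac-ends : ∀ n t → ac n (2 ℕ.+ t) ≡ Σ△ n (λ k b r → 𝟙 (¬? (k ≟ b)) ℕ.* ac r t)
ac-ends n t = begin
  ac n (2 ℕ.+ t)
    ≡⟨ ac≡Σcomp n (2 ℕ.+ t) ⟩
  Σcomp n (2 ℕ.+ t) AP
    ≡⟨ Σcomp-head n (suc t) AP ⟩
  Σ< n (λ k → Σcomp (n ∸ suc k) (suc t) (AP ∘ (suc k ∷_)))
    ≡⟨ Σ<-cong n (λ k → Σcomp-last t (n ∸ suc k) (AP ∘ (suc k ∷_))) ⟩
  Σ△ n (λ k b r → Σcomp r t (λ u → AP (suc k ∷ (u ∷ʳ suc b))))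
    ≡⟨ Σ<-cong n (λ k → Σ<-cong (n ∸ suc k) (λ b → fixed-ends k b (n ∸ suc k ∸ suc b))) ⟩
  Σ△ n (λ k b r → 𝟙 (¬? (k ≟ b)) ℕ.* ac r t) ∎
  where
  open ≡-Reasoning
  AP : ∀ {s} → Vec ℕ s → ℕ
  AP = 𝟙 ∘ antiPalindromic?
  fixed-ends : ∀ k b r → Σcomp r t (λ u → AP (suc k ∷ (u ∷ʳ suc b))) ≡ 𝟙 (¬? (k ≟ b)) ℕ.* ac r t
  fixed-ends k b r = begin
    Σcomp r t (λ u → AP (suc k ∷ (u ∷ʳ suc b)))
      ≡⟨ Σcomp-cong r t (𝟙-antiPalindromic-∷-∷ʳ (suc k) (suc b)) ⟩
    Σcomp r t (λ u → 𝟙 (¬? (k ≟ b)) ℕ.* AP u)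
      ≡⟨ Σcomp-*ˡ r t (𝟙 (¬? (k ≟ b))) AP ⟩
    𝟙 (¬? (k ≟ b)) ℕ.* Σcomp r t AP
      ≡⟨ cong (𝟙 (¬? (k ≟ b)) ℕ.*_) (ac≡Σcomp r t) ⟨
    𝟙 (¬? (k ≟ b)) ℕ.* ac r t ∎

ac-below : ℕ → ℕ → ℕ
ac-below m t = Σ< m (λ j → ac (m ∸ suc j) t)

ac-peel : ∀ m t → ac (2 ℕ.+ m) (2 ℕ.+ t) ≡ 2 ℕ.* ac-below m t ℕ.+ ac m (2 ℕ.+ t)
ac-peel m t = begin
  ac (2 ℕ.+ m) (2 ℕ.+ t)
    ≡⟨ ac-ends (2 ℕ.+ m) t ⟩
  Σ< m (λ j → 1 ℕ.* ac (m ∸ suc j) t) ℕ.+ Σ△ (suc m) (w ∘ suc)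
    ≡⟨ cong₂ ℕ._+_ (Σ<-cong m (λ j → ℕ.*-identityˡ _)) (Σ△-suc m (w ∘ suc)) ⟩
  S ℕ.+ (Σ< m (λ k → 1 ℕ.* ac (m ∸ suc k) t) ℕ.+ Σ△ m w)
    ≡⟨ cong (λ x → S ℕ.+ (x ℕ.+ Σ△ m w)) (Σ<-cong m (λ k → ℕ.*-identityˡ _)) ⟩
  S ℕ.+ (S ℕ.+ Σ△ m w)
    ≡⟨ cong (λ x → S ℕ.+ (S ℕ.+ x)) (ac-ends m t) ⟨
  S ℕ.+ (S ℕ.+ ac m (2 ℕ.+ t))
    ≡⟨ solve 2 (λ x y → x :+ (x :+ y) := con 2 :* x :+ y) refl S (ac m (2 ℕ.+ t)) ⟩
  2 ℕ.* S ℕ.+ ac m (2 ℕ.+ t) ∎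
  where
  open ≡-Reasoning
  open +-*-Solver
  w : ℕ → ℕ → ℕ → ℕ
  w k b r = 𝟙 (¬? (k ≟ b)) ℕ.* ac r t
  S : ℕ
  S = ac-below m t

-- ac-below (1 + m) t reduces to ac m t + ac-below m t.
ac-recurrence : ∀ m t →
  ac (3 ℕ.+ m) (2 ℕ.+ t) ℕ.+ ac m (2 ℕ.+ t) ≡
  ac (2 ℕ.+ m) (2 ℕ.+ t) ℕ.+ ac (1 ℕ.+ m) (2 ℕ.+ t) ℕ.+ 2 ℕ.* ac m t
ac-recurrence m t rewrite ac-peel (1 ℕ.+ m) t | ac-peel m t =
  solve 4 (λ a S A₁ A₀ → con 2 :* (a :+ S) :+ A₁ :+ A₀ := con 2 :* S :+ A₀ :+ A₁ :+ con 2 :* a)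
        refl (ac m t) (ac-below m t) (ac (1 ℕ.+ m) (2 ℕ.+ t)) (ac m (2 ℕ.+ t))
  where open +-*-Solver

pos-+-+-* : ∀ m n o p → + (m ℕ.+ n ℕ.+ o ℕ.* p) ≡ + m + + n + + o * + p
pos-+-+-* m n o p = trans (pos-+ (m ℕ.+ n) (o ℕ.* p)) (cong₂ _+_ (pos-+ m n) (pos-* o p))

m+n≡o⇒+m≡+o-+n : ∀ {m n o} → m ℕ.+ n ≡ o → + m ≡ + o - + n
m+n≡o⇒+m≡+o-+n {m} {n} refl = begin
  + m                   ≡⟨ cong +_ (ℕ.m+n∸n≡m m n) ⟨
  + (m ℕ.+ n ∸ n)       ≡⟨ ⊖-≥ (ℕ.m≤n+m n m) ⟨
  (m ℕ.+ n) ⊖ n         ≡⟨ [+m]-[+n]≡m⊖n (m ℕ.+ n) n ⟨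
  + (m ℕ.+ n) - + n     ∎
  where open ≡-Reasoning

lemma2 : (n s : ℕ) → 3 ≤ n → 2 ≤ s →
    + ac n s ≡ + ac (n ∸ 1) s + + ac (n ∸ 2) s + + 2 * + ac (n ∸ 3) (s ∸ 2) - + ac (n ∸ 3) s
lemma2 (suc (suc (suc m))) (suc (suc t)) (s≤s (s≤s (s≤s _))) (s≤s (s≤s _)) =
  trans (m+n≡o⇒+m≡+o-+n (ac-recurrence m t))
        (cong (_- + ac m (2 ℕ.+ t))
              (pos-+-+-* (ac (2 ℕ.+ m) (2 ℕ.+ t)) (ac (1 ℕ.+ m) (2 ℕ.+ t)) 2 (ac m t)))
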